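{- Let $G$ be a finite simple connected graph. Then $Md(G)=\sigma^{\times}_V(G)$, where $$Md(G)=\max_{l}\ \max\{m_G(f,g): f,g\ l\text{ -tracks on } G\},$$ the outer maximum running over all $l\in\mathbb{N}$ for which an $l$-track on $G$ exists.
   Context: $G$ is a finite simple connected graph with distance $d_G$. For $l\in\mathbb{N}$, $\mathbb{N}_l=\{1,\dots,l\}$. An $l$-track on $G$ is a surjective $f:\mathbb{N}_l\to V(G)$ with $f(i)f(i+1)\in E(G)$ for each $i\in\{1,\dots,l-1\}$. For $f,g:\mathbb{N}_l\to V(G)$, $m_G(f,g)=\min\{d_G(f(i),g(i)):i\in\mathbb{N}_l\}$. The direct product $G\times G$ has vertex set $V(G)\times V(G)$, with $(u,v),(u',v')$ adjacent iff $uu'\in E(G)$ and $vv'\in E(G)$. For a graph $H$ with $V(H)\subseteq V(G)\times V(G)$, $\varepsilon_G(H)=\min\{d_G(u,v):(u,v)\in V(H)\}$, and $p_1,p_2$ denote the coordinate projections. The direct vertex span of $G$ (Banič–Taranenko) is $\sigma^{\times}_V(G)=\max\{\varepsilon_G(H): H \text{ a connected subgraph of } G\times G \text{ with } p_1(V(H))=p_2(V(H))=V(G)\}$. -}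

module Defs where

open import Data.Nat using (ℕ; zero; suc; _≤_)
open import Data.Fin using (Fin; toℕ)
open import Data.Bool using (Bool; T)
open import Data.Product using (Σ; ∃; _×_; _,_)
open import Relation.Binary.PropositionalEquality using (_≡_)
open import Relation.Nullary using (¬_)

record Graph : Set where
  field
    n     : ℕ
    adj   : Fin (suc n) → Fin (suc n) → Bool
    sym   : ∀ u v → adj u v ≡ adj v u
    irrefl : ∀ u → ¬ T (adj u u)

  V : Set
  V = Fin (suc n)

  Edge : V → V → Set
  Edge u v = T (adj u v)

open Graph public

data Walk {A : Set} (R : A → A → Set) : A → A → ℕ → Set where
  here : ∀ {a} → Walk R a a zero
  step : ∀ {a b c k} → R a b → Walk R b c k → Walk R a c (suc k)

IsMax : (ℕ → Set) → ℕ → Set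
IsMax S k = S k × (∀ j → S j → j ≤ k)

IsMin : (ℕ → Set) → ℕ → Set
IsMin S k = S k × (∀ j → S j → k ≤ j)

module _ (G : Graph) where

  Dist : V G → V G → ℕ → Set
  Dist u v = IsMin (Walk (Edge G) u v)

  Connected : Set
  Connected = ∀ u v → ∃ λ k → Walk (Edge G) u v k

  -- l-track (with ℕ_l = {1..l} represented by Fin l = {0..l-1})
  IsTrack : (l : ℕ) → (Fin l → V G) → Set
  IsTrack l f = (∀ v → ∃ λ i → f i ≡ v)
              × (∀ (i j : Fin l) → toℕ j ≡ suc (toℕ i) → Edge G (f i) (f j))

  MinDist : (l : ℕ) → (Fin l → V G) → (Fin l → V G) → ℕ → Set
  MinDist l f g = IsMin (λ k → ∃ λ i → Dist (f i) (g i) k)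

  MdValue : ℕ → Set
  MdValue k = Σ ℕ λ l → Σ (Fin l → V G) λ f → Σ (Fin l → V G) λ g →
              IsTrack l f × IsTrack l g × MinDist l f g k

  IsMd : ℕ → Set
  IsMd = IsMax MdValue

  ProdEdge : V G × V G → V G × V G → Set
  ProdEdge (u , v) (u' , v') = Edge G u u' × Edge G v v'

  record Subgraph : Set where
    field
      HV : V G × V G → Bool
      HE : V G × V G → V G × V G → Bool
      HE-sym : ∀ a b → HE a b ≡ HE b a
      HE-prod : ∀ a b → T (HE a b) → ProdEdge a b
      HE-vert : ∀ a b → T (HE a b) → T (HV a) × T (HV b)

  open Subgraph public

  HEdge : Subgraph → V G × V G → V G × V G → Set
  HEdge H a b = T (HE H a b)

  SubConnected : Subgraph → Set
  SubConnected H = ∀ a b → T (HV H a) → T (HV H b) → ∃ λ k → Walk (HEdge H) a b k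

  ProjSurj : Subgraph → Set
  ProjSurj H = (∀ u → ∃ λ v → T (HV H (u , v))) × (∀ v → ∃ λ u → T (HV H (u , v)))

  Eps : Subgraph → ℕ → Set
  Eps H = IsMin (λ k → Σ (V G × V G) λ { (u , v) → T (HV H (u , v)) × Dist u v k })

  SpanValue : ℕ → Set
  SpanValue k = Σ Subgraph λ H → SubConnected H × ProjSurj H × Eps H k

  IsDirectVertexSpan : ℕ → Set
  IsDirectVertexSpan = IsMax SpanValue

-- Two l-tracks zip into a walk in G × G whose vertex set spans a connected subgraph projecting
-- onto V(G) in both coordinates, with ε equal to m(f, g); conversely, a walk through every vertex
-- of such a subgraph unzips into two tracks with m(f, g) equal to ε. So Md(G) and σ×_V(G) are maxima
-- of one and the same set of values, and it remains to see that this set has a maximum. It is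
-- bounded by the diameter, and "σ ≥ k" is decidable: it holds iff some pair at distance ≥ k reaches,
-- through pairs at distance ≥ k, pairs with every prescribed first and every prescribed second
-- coordinate, since the component of that pair is then a subgraph with ε ≥ k.

module Submission where

open import Data.Bool using (Bool; T; _∧_)
open import Data.Bool.Properties using (T-∧; ∧-comm)
open import Data.Empty using (⊥-elim)
open import Data.Fin as Fin using (Fin; zero; suc; toℕ; fromℕ<)
open import Data.Fin.Properties using (toℕ<n; toℕ-fromℕ<; all?; pigeonhole; *↔×)
import Data.Fin.Properties as Fin
open import Data.Nat using (ℕ; zero; suc; _+_; _*_; _∸_; _≤_; _<_; z≤n; s≤s; _≤?_; _<?_)
open import Data.Nat.Induction using (<-rec)
open import Data.Nat.Properties
  using ( ≤-trans; ≤-antisym; ≤∧≢⇒<; ≮⇒≥; n≤0⇒n≡0; +-suc; +-identityʳ; +-monoˡ-<; m+[n∸m]≡n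
        ; <⇒≤pred)
import Data.Nat.Properties as ℕ
open import Data.Product using (Σ; ∃; _×_; _,_; proj₁; proj₂; uncurry; swap)
open import Data.Product.Properties using (≡-dec)
open import Function using (_∘_; id; _↔_; Inverse; Injection; Equivalence)
open import Function.Construct.Identity using (↔-id)
open import Function.Construct.Symmetry using (↔-sym)
open import Function.Properties.Inverse using (↔⇒↣)
open import Relation.Binary using (Symmetric; DecidableEquality)
import Relation.Binary as B
open import Relation.Binary.PropositionalEquality using (_≡_; refl; sym; cong; cong₂; subst)
open import Relation.Nullary using (Dec; yes; no)
open import Relation.Nullary.Decidable using (map′; _×-dec_; ⌊_⌋; toWitness; fromWitness; T?; via-injection)
open import Relation.Unary using (Decidable; _≐_)

open import Defs hiding (sym)

module _ {S : ℕ → Set} (S? : Decidable S) where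

  private
    leastFrom : ∀ k m → (∀ j → S j → m ≤ j) → S (k + m) → ∃ (IsMin S)
    leastFrom k m below s with S? m
    ... | yes sm = m , sm , below
    leastFrom zero    m below s | no ¬sm = ⊥-elim (¬sm s)
    leastFrom (suc k) m below s | no ¬sm =
      leastFrom k (suc m) (λ j sj → ≤∧≢⇒< (below j sj) (λ m≡j → ¬sm (subst S (sym m≡j) sj)))
                (subst S (sym (+-suc k m)) s)

  least : ∃ S → ∃ (IsMin S)
  least (k , s) = leastFrom k 0 (λ _ _ → z≤n) (subst S (sym (+-identityʳ k)) s)

  greatest : ∀ m → (∀ j → S j → j ≤ m) → ∃ S → ∃ (IsMax S)
  greatest m above s with S? m
  ... | yes sm = m , sm , above
  greatest zero    above (j , sj) | no ¬sm = ⊥-elim (¬sm (subst S (n≤0⇒n≡0 (above j sj)) sj))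
  greatest (suc m) above s        | no ¬sm =
    greatest m (λ j sj → <⇒≤pred (≤∧≢⇒< (above j sj) (λ j≡m → ¬sm (subst S j≡m sj)))) s

module _ {S S′ : ℕ → Set} (S≐S′ : S ≐ S′) {k : ℕ} where

  IsMin-≐ : IsMin S k → IsMin S′ k
  IsMin-≐ (s , min) = proj₁ S≐S′ s , λ j s′ → min j (proj₂ S≐S′ s′)

  IsMax-≐ : IsMax S k → IsMax S′ k
  IsMax-≐ (s , max) = proj₁ S≐S′ s , λ j s′ → max j (proj₂ S≐S′ s′)

IsMin-unique : ∀ {S : ℕ → Set} {k k′} → IsMin S k → IsMin S k′ → k ≡ k′
IsMin-unique (s , min) (s′ , min′) = ≤-antisym (min _ s′) (min′ _ s)

module FiniteType {A : Set} {N : ℕ} (enum : A ↔ Fin N) where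

  open Inverse enum

  every : ∀ {P : A → Set} → (∀ i → P (from i)) → ∀ x → P x
  every {P} p x = subst P (strictlyInverseʳ x) (p (to x))

  _≟_ : DecidableEquality A
  _≟_ = via-injection (↔⇒↣ enum) Fin._≟_

  any? : ∀ {Q : A → Set} → Decidable Q → Dec (∃ Q)
  any? {Q} Q? = map′ (λ (i , q) → from i , q)
                     (λ (x , q) → to x , subst Q (sym (strictlyInverseʳ x)) q)
                     (Fin.any? (Q? ∘ from))


module Walks {A : Set} {R : A → A → Set} where

  infixr 5 _++ʷ_
  infixl 5 _∷ʳ_

  _++ʷ_ : ∀ {a b c k m} → Walk R a b k → Walk R b c m → Walk R a c (k + m)
  here     ++ʷ w = w
  step r v ++ʷ w = step r (v ++ʷ w)

  _∷ʳ_ : ∀ {a b c k} → Walk R a b k → R b c → Walk R a c (suc k)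
  here     ∷ʳ r = step r here
  step s w ∷ʳ r = step s (w ∷ʳ r)

  gmap : ∀ {B : Set} {S : B → B → Set} (φ : A → B) → (∀ {x y} → R x y → S (φ x) (φ y)) →
         ∀ {a b k} → Walk R a b k → Walk S (φ a) (φ b) k
  gmap φ f here       = here
  gmap φ f (step r w) = step (f r) (gmap φ f w)

  map-invariant : ∀ {S : A → A → Set} (Q : A → Set) → (∀ {x y} → Q x → R x y → Q y × S x y) →
                  ∀ {a b k} → Q a → Walk R a b k → Walk S a b k
  map-invariant Q f qa here       = here
  map-invariant Q f qa (step r w) = let (qb , s) = f qa r in step s (map-invariant Q f qb w)

  endpoint-invariant : (Q : A → Set) → (∀ {x y} → R x y → Q y) → ∀ {a b k} → Q a → Walk R a b k → Q b
  endpoint-invariant Q f qa here       = qa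
  endpoint-invariant Q f qa (step r w) = endpoint-invariant Q f (f r) w

  along : ∀ {l} (h : Fin (suc l) → A) → (∀ i j → toℕ j ≡ suc (toℕ i) → R (h i) (h j)) →
          ∀ i → ∃ (Walk R (h zero) (h i))
  along h steps zero = 0 , here
  along {suc l} h steps (suc i) =
    let (k , w) = along (h ∘ suc) (λ i j e → steps (suc i) (suc j) (cong suc e)) i
    in suc k , step (steps zero (suc zero) refl) w

  vertex : ∀ {a b k} → Walk R a b k → Fin (suc k) → A
  vertex {a} w          zero    = a
  vertex     (step r w) (suc i) = vertex w i

  vertex-step : ∀ {a b k} (w : Walk R a b k) (i j : Fin (suc k)) → toℕ j ≡ suc (toℕ i) →
                R (vertex w i) (vertex w j)
  vertex-step (step r w) zero    (suc zero) _ = r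
  vertex-step (step r w) (suc i) (suc j)    e = vertex-step w i j (ℕ.suc-injective e)
  vertex-step here       zero    zero       ()
  vertex-step (step r w) zero    zero       ()
  vertex-step (step r w) zero    (suc (suc j)) ()
  vertex-step (step r w) (suc i) zero       ()

  take : ∀ {a b k} (w : Walk R a b k) (i : Fin (suc k)) → Walk R a (vertex w i) (toℕ i)
  take w          zero    = here
  take (step r w) (suc i) = step r (take w i)

  drop : ∀ {a b k} (w : Walk R a b k) (i : Fin (suc k)) → Walk R (vertex w i) b (k ∸ toℕ i)
  drop w          zero    = w
  drop (step r w) (suc i) = drop w i

  cut-loop : ∀ {a b k} (w : Walk R a b k) {i j : Fin (suc k)} → i Fin.< j → vertex w i ≡ vertex w j →
             ∃ λ m → m < k × Walk R a b m
  cut-loop {b = b} {k} w {i} {j} i<j same =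
    toℕ i + (k ∸ toℕ j) ,
    subst (toℕ i + (k ∸ toℕ j) <_) (m+[n∸m]≡n (<⇒≤pred (toℕ<n j))) (+-monoˡ-< (k ∸ toℕ j) i<j) ,
    take w i ++ʷ subst (λ x → Walk R x b (k ∸ toℕ j)) (sym same) (drop w j)

  Visits : ∀ {a b k} → Walk R a b k → A → Set
  Visits {k = k} w x = ∃ λ (i : Fin (suc k)) → vertex w i ≡ x

  visits-end : ∀ {a b k} (w : Walk R a b k) → Visits w b
  visits-end here       = zero , refl
  visits-end (step r w) = let (i , e) = visits-end w in suc i , e

  visits-++ˡ : ∀ {a b c k m} (v : Walk R a b k) (w : Walk R b c m) {x} → Visits v x → Visits (v ++ʷ w) x
  visits-++ˡ v          w (zero , e)  = zero , e
  visits-++ˡ (step r v) w (suc i , e) = let (j , e′) = visits-++ˡ v w (i , e) in suc j , e′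

  visits-++ʳ : ∀ {a b c k m} (v : Walk R a b k) (w : Walk R b c m) {x} → Visits w x → Visits (v ++ʷ w) x
  visits-++ʳ here       w vis = vis
  visits-++ʳ (step r v) w vis = let (j , e) = visits-++ʳ v w vis in suc j , e

  ClosedWalk : A → Set
  ClosedWalk a = ∃ (Walk R a a)

  concat-closed : ∀ {m a} (c : Fin m → ClosedWalk a) →
                  Σ (ClosedWalk a) λ w → ∀ i {x} → Visits (proj₂ (c i)) x → Visits (proj₂ w) x
  concat-closed {zero}  c = (0 , here) , λ ()
  concat-closed {suc m} c =
    let ((_ , w) , visits) = concat-closed (c ∘ suc) ; v = proj₂ (c zero) in
    (_ , v ++ʷ w) , λ where
      zero    → visits-++ˡ v w
      (suc i) → λ vis → visits-++ʳ v w (visits i vis)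

  module _ (R-sym : Symmetric R) where

    reverse : ∀ {a b k} → Walk R a b k → Walk R b a k
    reverse here       = here
    reverse (step r w) = reverse w ∷ʳ R-sym r

    walk-through : ∀ {a x y} → ∃ (Walk R a x) → ∃ (Walk R a y) → ∃ (Walk R x y)
    walk-through (_ , v) (_ , w) = _ , reverse v ++ʷ w

  module Finite {N : ℕ} (enum : A ↔ Fin N) where

    open Inverse enum
    open FiniteType enum

    private
      Shortenable : ℕ → Set
      Shortenable k = ∀ {a b} → Walk R a b k → ∃ λ j → j < N × Walk R a b j

    -- A walk of length at least N repeats a vertex, by the pigeonhole principle.
    shorten : ∀ {k} → Shortenable k
    shorten {k} = <-rec Shortenable go k
      where
        go : ∀ k → (∀ {m} → m < k → Shortenable m) → Shortenable k
        go k rec w with k <? N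
        ... | yes k<N = k , k<N , w
        ... | no  k≮N with pigeonhole (s≤s (≮⇒≥ k≮N)) (to ∘ vertex w)
        ...   | i , j , i<j , same =
                  let (m , m<k , w′) = cut-loop w i<j (Injection.injective (↔⇒↣ enum) same) in rec m<k w′

    module _ (R? : B.Decidable R) where

      walk? : ∀ k a b → Dec (Walk R a b k)
      walk? zero    a b = map′ (λ { refl → here }) (λ { here → refl }) (a ≟ b)
      walk? (suc k) a b = map′ (λ (c , r , w) → step r w) (λ { (step r w) → _ , r , w })
                               (any? λ c → R? a c ×-dec walk? k c b)

      reachable? : ∀ a b → Dec (∃ (Walk R a b))
      reachable? a b =
        map′ (λ (i , w) → toℕ i , w)
             (λ (k , w) → let (j , j<N , w′) = shorten w in
                          fromℕ< j<N , subst (Walk R a b) (sym (toℕ-fromℕ< j<N)) w′)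
             (Fin.any? λ i → walk? (toℕ i) a b)

    tour : (R-sym : Symmetric R) {a : A} {S : A → Set} → Decidable S → (∀ {x} → S x → ∃ (Walk R a x)) →
           ∃ λ k → Σ (Walk R a a k) λ w → ∀ {x} → S x → Visits w x
    tour R-sym {a} {S} S? reach =
      let ((k , w) , visits) = concat-closed (proj₁ ∘ roundTrip) in
      k , w , λ {x} → every (λ i s → visits i (proj₂ (roundTrip i) s)) x
      where
        roundTrip : (i : Fin N) → Σ (ClosedWalk a) λ c → S (from i) → Visits (proj₂ c) (from i)
        roundTrip i with S? (from i)
        ... | yes s = let (_ , w) = reach s in
                      (_ , w ++ʷ reverse R-sym w) , λ _ → visits-++ˡ w _ (visits-end w)
        ... | no ¬s = (_ , here) , λ s → ⊥-elim (¬s s)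

module _ (G : Graph) where

  private
    Pair : Set
    Pair = V G × V G

  vertices : V G ↔ Fin (suc (n G))
  vertices = ↔-id _

  pairs : Pair ↔ Fin (suc (n G) * suc (n G))
  pairs = ↔-sym *↔×

  Edge? : B.Decidable (Edge G)
  Edge? u v = T? (adj G u v)

  induced : (Pair → Bool) → Subgraph G
  induced S = record
    { HV     = S
    ; HE     = λ x y → (S x ∧ S y) ∧ (adj G (proj₁ x) (proj₁ y) ∧ adj G (proj₂ x) (proj₂ y))
    ; HE-sym = λ x y → cong₂ _∧_ (∧-comm (S x) (S y))
                         (cong₂ _∧_ (Graph.sym G (proj₁ x) (proj₁ y)) (Graph.sym G (proj₂ x) (proj₂ y)))
    ; HE-prod = λ x y e → Equivalence.to T-∧ (proj₂ (Equivalence.to (T-∧ {S x ∧ S y}) e))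
    ; HE-vert = λ x y e → Equivalence.to T-∧ (proj₁ (Equivalence.to (T-∧ {S x ∧ S y}) e))
    }

  induced-edge : ∀ S {x y} → T (S x) → T (S y) → ProdEdge G x y → HEdge G (induced S) x y
  induced-edge S x∈S y∈S e =
    Equivalence.from T-∧ (Equivalence.from T-∧ (x∈S , y∈S) , Equivalence.from T-∧ e)

  HEdge-sym : (H : Subgraph G) → Symmetric (HEdge G H)
  HEdge-sym H {x} {y} = subst T (HE-sym H x y)

  module _ (H : Subgraph G) {l} (h : Fin l → Pair) (h∈H : ∀ i → T (HV H (h i)))
           (h-onto : ∀ {p} → T (HV H p) → ∃ λ i → h i ≡ p) where

    Eps≐MinDist : (λ j → Σ Pair λ p → T (HV H p) × uncurry (Dist G) p j)
                ≐ (λ j → ∃ λ i → uncurry (Dist G) (h i) j)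
    Eps≐MinDist =
      (λ {j} (p , p∈H , d) → let (i , e) = h-onto p∈H in i , subst (λ q → uncurry (Dist G) q j) (sym e) d) ,
      (λ (i , d) → h i , h∈H i , d)

  walk⇒MdValue : ∀ {k} (H : Subgraph G) → ProjSurj G H → Eps G H k →
                 ∀ {a b K} → T (HV H a) → (w : Walk (HEdge G H) a b K) →
                 (∀ {p} → T (HV H p) → Walks.Visits w p) → MdValue G k
  walk⇒MdValue H (cover₁ , cover₂) isEps {K = K} a∈H w visits =
    suc K , f , g , (f-onto , f-step) , (g-onto , g-step) ,
    IsMin-≐ (Eps≐MinDist H (vertex w) vertex∈H visits) isEps
    where
      open Walks {R = HEdge G H} using (vertex; vertex-step; endpoint-invariant; take)

      f g : Fin (suc K) → V G
      f i = proj₁ (vertex w i)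
      g i = proj₂ (vertex w i)

      f-onto : ∀ u → ∃ λ i → f i ≡ u
      f-onto u = let (v , uv∈H) = cover₁ u ; (i , e) = visits uv∈H in i , cong proj₁ e

      g-onto : ∀ v → ∃ λ i → g i ≡ v
      g-onto v = let (u , uv∈H) = cover₂ v ; (i , e) = visits uv∈H in i , cong proj₂ e

      f-step : ∀ i j → toℕ j ≡ suc (toℕ i) → Edge G (f i) (f j)
      f-step i j e = proj₁ (HE-prod H _ _ (vertex-step w i j e))

      g-step : ∀ i j → toℕ j ≡ suc (toℕ i) → Edge G (g i) (g j)
      g-step i j e = proj₂ (HE-prod H _ _ (vertex-step w i j e))

      vertex∈H : ∀ i → T (HV H (vertex w i))
      vertex∈H i = endpoint-invariant (T ∘ HV H) (λ {x} {y} e → proj₂ (HE-vert H x y e)) a∈H (take w i)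

  SpanValue⇒MdValue : ∀ {k} → SpanValue G k → MdValue G k
  SpanValue⇒MdValue (H , connected , cover , isEps) =
    let a∈H = proj₂ (proj₁ cover zero)
        (_ , w , visits) = Walks.Finite.tour pairs (HEdge-sym H) (λ p → T? (HV H p)) (connected _ _ a∈H)
    in walk⇒MdValue H cover isEps a∈H w visits

  MdValue⇒SpanValue : ∀ {k} → MdValue G k → SpanValue G k
  MdValue⇒SpanValue (zero , f , g , (f-onto , _) , _) with () ← proj₁ (f-onto zero)
  MdValue⇒SpanValue (suc l , f , g , (f-onto , f-step) , (g-onto , g-step) , isMd) =
    H , connected , (cover₁ , cover₂) , IsMin-≐ (swap (Eps≐MinDist H h h∈H toWitness)) isMd
    where
      h : Fin (suc l) → Pair
      h i = f i , g i

      image : Pair → Bool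
      image p = ⌊ Fin.any? (λ i → ≡-dec Fin._≟_ Fin._≟_ (h i) p) ⌋

      H : Subgraph G
      H = induced image
      open Walks {R = HEdge G H} using (along; walk-through)

      h∈H : ∀ i → T (image (h i))
      h∈H i = fromWitness (i , refl)

      h-step : ∀ i j → toℕ j ≡ suc (toℕ i) → HEdge G H (h i) (h j)
      h-step i j e = induced-edge image (h∈H i) (h∈H j) (f-step i j e , g-step i j e)

      connected : SubConnected G H
      connected p q p∈H q∈H with toWitness p∈H | toWitness q∈H
      ... | i , refl | j , refl = walk-through (HEdge-sym H) (along h h-step i) (along h h-step j)

      cover₁ : ∀ u → ∃ λ v → T (image (u , v))
      cover₁ u with f-onto u
      ... | i , refl = g i , h∈H i

      cover₂ : ∀ v → ∃ λ u → T (image (u , v))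
      cover₂ v with g-onto v
      ... | i , refl = f i , h∈H i

module _ (G : Graph) (conn : Connected G) where

  private
    Pair : Set
    Pair = V G × V G

  open Walks.Finite {R = Edge G} (vertices G) using (shorten; walk?)

  opaque
    shortest : ∀ u v → ∃ (Dist G u v)
    shortest u v = least (λ k → walk? (Edge? G) k u v) (conn u v)

  distance : V G → V G → ℕ
  distance u v = proj₁ (shortest u v)

  distance-Dist : ∀ u v → Dist G u v (distance u v)
  distance-Dist u v = proj₂ (shortest u v)

  Dist⇒≡distance : ∀ {u v k} → Dist G u v k → k ≡ distance u v
  Dist⇒≡distance {u} {v} d = IsMin-unique d (distance-Dist u v)

  Dist? : ∀ u v k → Dec (Dist G u v k)
  Dist? u v k = map′ (λ { refl → distance-Dist u v }) Dist⇒≡distance (k ℕ.≟ distance u v)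

  distance≤n : ∀ u v → distance u v ≤ n G
  distance≤n u v =
    let (j , j<N , w) = shorten (proj₁ (distance-Dist u v))
    in ≤-trans (proj₂ (distance-Dist u v) j w) (<⇒≤pred j<N)

  δ : Pair → ℕ
  δ (u , v) = distance u v

  FarEdge : ℕ → Pair → Pair → Set
  FarEdge k x y = ProdEdge G x y × k ≤ δ x × k ≤ δ y

  FarEdge? : ∀ k → B.Decidable (FarEdge k)
  FarEdge? k x y = (Edge? G _ _ ×-dec Edge? G _ _) ×-dec k ≤? δ x ×-dec k ≤? δ y

  Reach : ℕ → Pair → Pair → Set
  Reach k a b = ∃ (Walk (FarEdge k) a b)

  opaque
    Reach? : ∀ k a b → Dec (Reach k a b)
    Reach? k = Walks.Finite.reachable? (pairs G) (FarEdge? k)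

  -- σ×_V(G) ≥ k, in decidable form.
  SpanAtLeast : ℕ → Set
  SpanAtLeast k = Σ Pair λ a → k ≤ δ a × (∀ u → ∃ λ v → Reach k a (u , v))
                                       × (∀ v → ∃ λ u → Reach k a (u , v))

  SpanAtLeast? : Decidable SpanAtLeast
  SpanAtLeast? k = FiniteType.any? (pairs G) λ a →
    k ≤? δ a ×-dec all? (λ u → Fin.any? λ v → Reach? k a (u , v))
             ×-dec all? (λ v → Fin.any? λ u → Reach? k a (u , v))

  SpanAtLeast-zero : SpanAtLeast 0
  SpanAtLeast-zero = (zero , zero) , z≤n , (λ u → u , diagonal u) , (λ v → v , diagonal v)
    where
      diagonal : ∀ u → Reach 0 (zero , zero) (u , u)
      diagonal u = let (k , w) = conn zero u in k , Walks.gmap (λ x → x , x) (λ e → (e , e) , z≤n , z≤n) w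

  SpanAtLeast-bounded : ∀ {k} → SpanAtLeast k → k ≤ n G
  SpanAtLeast-bounded ((u , v) , k≤δa , _) = ≤-trans k≤δa (distance≤n u v)

  Eps-exists : (H : Subgraph G) → ∀ {a} → T (HV H a) → ∃ (Eps G H)
  Eps-exists H {a} a∈H =
    least (λ j → FiniteType.any? (pairs G) λ (u , v) → T? (HV H (u , v)) ×-dec Dist? u v j)
          (δ a , a , a∈H , distance-Dist _ _)

  SpanAtLeast⇒SpanValue : ∀ {k} → SpanAtLeast k → ∃ λ k′ → k ≤ k′ × SpanValue G k′
  SpanAtLeast⇒SpanValue {k} (a , k≤δa , cover₁ , cover₂) =
    let (ε , isEps) = Eps-exists H a∈H ; (p , p∈H , d) = proj₁ isEps in
    ε , subst (k ≤_) (sym (Dist⇒≡distance d)) (far p∈H) , H , connected , (cover₁′ , cover₂′) , isEps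
    where
      component : Pair → Bool
      component p = ⌊ Reach? k a p ⌋

      H : Subgraph G
      H = induced G component

      a∈H : T (component a)
      a∈H = fromWitness (0 , here)

      far : ∀ {p} → T (component p) → k ≤ δ p
      far p∈H = Walks.endpoint-invariant {R = FarEdge k} (λ p → k ≤ δ p) (proj₂ ∘ proj₂) k≤δa
                                         (proj₂ (toWitness p∈H))

      reach-in-H : ∀ {p j} → Walk (FarEdge k) a p j → Walk (HEdge G H) a p j
      reach-in-H = Walks.map-invariant {R = FarEdge k} (T ∘ component)
        (λ x∈H e → let y∈H = fromWitness (_ , proj₂ (toWitness x∈H) Walks.∷ʳ e) in
                   y∈H , induced-edge G component x∈H y∈H (proj₁ e))
        a∈H

      walk-in-H : ∀ {p} → T (component p) → ∃ (Walk (HEdge G H) a p)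
      walk-in-H p∈H = let (j , w) = toWitness p∈H in j , reach-in-H w

      connected : SubConnected G H
      connected p q p∈H q∈H = Walks.walk-through (HEdge-sym G H) (walk-in-H p∈H) (walk-in-H q∈H)

      cover₁′ : ∀ u → ∃ λ v → T (component (u , v))
      cover₁′ u = let (v , r) = cover₁ u in v , fromWitness r

      cover₂′ : ∀ v → ∃ λ u → T (component (u , v))
      cover₂′ v = let (u , r) = cover₂ v in u , fromWitness r

  SpanValue⇒SpanAtLeast : ∀ {k} → SpanValue G k → SpanAtLeast k
  SpanValue⇒SpanAtLeast {k} (H , connected , (cover₁ , cover₂) , isEps) =
    a , far a∈H , (λ u → let (v , uv∈H) = cover₁ u in v , reach uv∈H)
                , (λ v → let (u , uv∈H) = cover₂ v in u , reach uv∈H)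
    where
      a : Pair
      a = zero , proj₁ (cover₁ zero)

      a∈H : T (HV H a)
      a∈H = proj₂ (cover₁ zero)

      far : ∀ {p} → T (HV H p) → k ≤ δ p
      far {p} p∈H = proj₂ isEps (δ p) (p , p∈H , distance-Dist _ _)

      far-edge : ∀ {x y} → HEdge G H x y → FarEdge k x y
      far-edge {x} {y} e = HE-prod H x y e , far (proj₁ (HE-vert H x y e)) , far (proj₂ (HE-vert H x y e))

      reach : ∀ {p} → T (HV H p) → Reach k a p
      reach {p} p∈H = let (j , w) = connected a p a∈H p∈H in j , Walks.gmap id far-edge w

  SpanValue-max : ∃ (IsMax (SpanValue G))
  SpanValue-max =
    let (K , atLeast-K , K-max) =
          greatest SpanAtLeast? (n G) (λ _ → SpanAtLeast-bounded) (0 , SpanAtLeast-zero)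
        (k , K≤k , span-k) = SpanAtLeast⇒SpanValue atLeast-K
    in k , span-k , λ j span-j → ≤-trans (K-max j (SpanValue⇒SpanAtLeast span-j)) K≤k

theorem3p3 : (G : Graph) → Connected G →
    ∃ λ (k : ℕ) → IsMd G k × IsDirectVertexSpan G k
theorem3p3 G conn =
  let (k , isMax) = SpanValue-max G conn
  in k , IsMax-≐ (SpanValue⇒MdValue G , MdValue⇒SpanValue G) isMax , isMax
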